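{- Let $G$ be a digraph with a proper vertex coloring $\sigma\colon V(G)\to\{r,s\}$ using (at most) two colors. Then $(G,\sigma)$ is a qBMG if and only if it satisfies (N1), (N2) and (N3).
   Context: Digraphs are finite and simple; $\sigma$ proper means $\sigma(x)=\sigma(y)$ implies $xy,yx\notin E(G)$. $N(x)$ is the set of out-neighbours of $x$, and for $A\subseteq V(G)$, $N(A)=\bigcup_{x\in A}N(x)$. Conditions, for all $x,y\in V(G)$: (N1) if $x\notin N(y)$ and $y\notin N(x)$ then $N(x)\cap N(N(y))=N(y)\cap N(N(x))=\emptyset$; (N2) $N(N(N(x)))\subseteq N(x)$; (N3) if $N(x)\cap N(y)\ne\emptyset$ then $N(x)\subseteq N(y)$ or $N(y)\subseteq N(x)$. All rooted trees are phylogenetic; $v\preceq_T u$ means $u$ is on the path from the root $\rho_T$ to $v$; $\mathrm{lca}_T$ is the least common ancestor. In a leaf-colored tree $(T,\sigma)$, leaf $y$ is a best match of leaf $x$ if $\sigma(x)\ne\sigma(y)$ and $\mathrm{lca}_T(x,y)\preceq_T\mathrm{lca}_T(x,y')$ for all leaves $y'$ with $\sigma(y')=\sigma(y)$. A truncation map $u\colon L(T)\times S\to V(T)$ (with $\sigma(L(T))\subseteq S$) sends $(x,s)$ to a vertex on the path from $\rho_T$ to $x$ with $u(x,\sigma(x))=x$; $y$ is a quasi-best match of $x$ if it is a best match and $\mathrm{lca}_T(x,y)\preceq_T u(x,\sigma(y))$. $(G,\sigma)$ is a qBMG if it equals, as vertex-colored digraph, the digraph on $L(T)$ with arcs $xy$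 for quasi-best matches $y$ of $x$, for some $(T,\sigma,u)$. -}

module Defs where

open import Data.Nat using (ℕ; _≤_; _<_)
open import Data.Nat.Properties using (_≟_)
open import Data.Fin using (Fin; toℕ)
open import Data.Bool using (Bool; true; false)
open import Data.List using (List; []; _∷_; length; lookup)
open import Data.List.Relation.Unary.All using (All)
open import Data.Product using (Σ; ∃; ∃-syntax; _×_; _,_)
open import Data.Sum using (_⊎_)
open import Relation.Nullary using (¬_; yes; no)
open import Relation.Binary.PropositionalEquality using (_≡_; _≢_)
open import Function.Bundles using (_⇔_)

record Digraph (n : ℕ) : Set where
  field
    E       : Fin n → Fin n → Bool
    noLoops : ∀ x → E x x ≡ false

open Digraph public

Arc : ∀ {n} → Digraph n → Fin n → Fin n → Set
Arc G x y = E G x y ≡ true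

Coloring : ℕ → Set
Coloring n = Fin n → Fin 2

Proper : ∀ {n} → Digraph n → Coloring n → Set
Proper G σ = ∀ x y → σ x ≡ σ y → ¬ Arc G x y × ¬ Arc G y x

InN : ∀ {n} → Digraph n → Fin n → Fin n → Set
InN G x z = Arc G x z

InNN : ∀ {n} → Digraph n → Fin n → Fin n → Set
InNN G x z = ∃[ w ] (Arc G x w × Arc G w z)

InNNN : ∀ {n} → Digraph n → Fin n → Fin n → Set
InNNN G x z = ∃[ w ] (InNN G x w × Arc G w z)

N1 : ∀ {n} → Digraph n → Set
N1 G = ∀ x y → ¬ InN G y x → ¬ InN G x y →
       (∀ z → ¬ (InN G x z × InNN G y z)) × (∀ z → ¬ (InN G y z × InNN G x z))

N2 : ∀ {n} → Digraph n → Set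
N2 G = ∀ x z → InNNN G x z → InN G x z

N3 : ∀ {n} → Digraph n → Set
N3 G = ∀ x y → (∃[ z ] (InN G x z × InN G y z)) →
       (∀ z → InN G x z → InN G y z) ⊎ (∀ z → InN G y z → InN G x z)

-- Rooted trees with leaves labelled by Fin n.
-- A vertex of a tree is identified with its position: the list of child
-- indices along the path from the root.

data Tree (n : ℕ) : Set where
  leaf : Fin n → Tree n
  node : List (Tree n) → Tree n

data Phylo {n : ℕ} : Tree n → Set where
  leafP : ∀ x → Phylo (leaf x)
  nodeP : ∀ {ts} → 2 ≤ length ts → All Phylo ts → Phylo (node ts)

Pos : Set
Pos = List ℕ

data LeafAt {n : ℕ} : Tree n → Pos → Fin n → Set where
  here  : ∀ x → LeafAt (leaf x) [] x
  there : ∀ {ts} (i : Fin (length ts)) {p x} →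
          LeafAt (lookup ts i) p x → LeafAt (node ts) (toℕ i ∷ p) x

LeafBij : ∀ {n} → Tree n → (Fin n → Pos) → Set
LeafBij {n} t pos = (∀ x → LeafAt t (pos x) x) × (∀ p x → LeafAt t p x → p ≡ pos x)

data IsPrefix : Pos → Pos → Set where
  []  : ∀ {q} → IsPrefix [] q
  _∷_ : ∀ a {p q} → IsPrefix p q → IsPrefix (a ∷ p) (a ∷ q)

-- v ⪯ u  iff  u is on the path from the root to v
_⪯_ : Pos → Pos → Set
v ⪯ u = IsPrefix u v

lca : Pos → Pos → Pos
lca (a ∷ p) (b ∷ q) with a ≟ b
... | yes _ = a ∷ lca p q
... | no  _ = []
lca _ _ = []

BestMatch : ∀ {n} → (Fin n → Pos) → Coloring n → Fin n → Fin n → Set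
BestMatch pos σ x y =
  σ x ≢ σ y × (∀ y' → σ y' ≡ σ y → lca (pos x) (pos y) ⪯ lca (pos x) (pos y'))

TruncationMap : ∀ {n} → (Fin n → Pos) → Coloring n → (Fin n → Fin 2 → Pos) → Set
TruncationMap pos σ u = (∀ x s → pos x ⪯ u x s) × (∀ x → u x (σ x) ≡ pos x)

QuasiBestMatch : ∀ {n} → (Fin n → Pos) → Coloring n → (Fin n → Fin 2 → Pos) →
                 Fin n → Fin n → Set
QuasiBestMatch pos σ u x y =
  BestMatch pos σ x y × (lca (pos x) (pos y) ⪯ u x (σ y))

qBMG : ∀ {n} → Digraph n → Coloring n → Set
qBMG {n} G σ =
  Σ (Tree n) λ T → Phylo T × Σ (Fin n → Pos) λ pos → LeafBij T pos ×
  Σ (Fin n → Fin 2 → Pos) λ u → TruncationMap pos σ u ×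
  (∀ x y → Arc G x y ⇔ QuasiBestMatch pos σ u x y)

{-# OPTIONS --safe #-}
-- Necessity: if a is a quasi-best match of x, so is every leaf y of a's colour with
-- lca(x,y) ⪯ lca(x,a); comparing the lcas along the paths occurring in
-- (N1)–(N3) then yields each condition.
--
-- Sufficiency: put K(x) = N(x) ∪ {y : σ y = σ x, y ∈ N(N(x)) or ∅ ≠ N(y) ⊆ N(x)}.
-- Under (N1)–(N3) the sets K(x), the whole vertex set and the singletons form a
-- hierarchy, and in its tree z ⪯ lca(x,y) holds exactly when every cluster containing
-- x and y contains z. In that tree the best matches of a vertex with out-neighbours
-- are exactly its out-neighbours, so the truncation map only has to remove the
-- best matches of sinks.
module Submission where

open import Defs
open import Data.Bool using (true) renaming (_≟_ to _≟ᵇ_)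
open import Data.Empty using (⊥; ⊥-elim)
open import Data.Fin using (Fin; zero; suc; toℕ; fromℕ<) renaming (_≟_ to _≟ᶠ_)
open import Data.Fin.Properties using (any?; all?; toℕ-injective)
open import Data.Fin.Subset using (Subset; _∈_; _∉_; _⊆_; _⊂_; ⁅_⁆; ⊤; ∣_∣; Nonempty)
  renaming (⊥ to ∅)
open import Data.Fin.Subset.Properties
  using (_∈?_; _⊆?_; _⊂?_; nonempty?; ⊆-refl; ⊆-trans; ⊆-antisym; ⊆⊤; ∈⊤; ⊥⊆; ∉⊥;
         x∈⁅x⁆; x∈⁅y⁆⇒x≡y; ∣p∣≤n; p⊂q⇒∣p∣<∣q∣)
open import Data.List using (List; []; _∷_; _++_; length; lookup; map; filter; deduplicate; allFin)
open import Data.List.Properties using (length-map)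
open import Data.List.Membership.Propositional using (lose) renaming (_∈_ to _∈ᴸ_)
open import Data.List.Membership.Propositional.Properties
  using (∈-filter⁺; ∈-filter⁻; ∈-deduplicate⁺; ∈-deduplicate⁻; ∈-lookup;
         ∈-map⁺; ∈-map⁻; ∈-++⁺ˡ; ∈-++⁺ʳ; ∈-++⁻; ∈-allFin)
open import Data.List.Relation.Unary.All as All using (All)
open import Data.List.Relation.Unary.All.Properties using (map⁺)
open import Data.List.Relation.Unary.AllPairs using (_∷_)
open import Data.List.Relation.Unary.Any as Any using (Any; here; there; index)
open import Data.List.Relation.Unary.Any.Properties using (lookup-index)
open import Data.List.Relation.Unary.Unique.Propositional using (Unique)
import Data.List.Relation.Unary.Unique.DecPropositional.Properties as UniqueDec
open import Data.Nat using (ℕ; zero; suc; _≤_; _<_; s≤s; z≤n)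
open import Data.Nat.Properties using (_≟_; <-≤-trans; m<1+n⇒m≤n)
open import Data.Product using (∃; ∃-syntax; _×_; _,_; proj₁; proj₂)
open import Data.Sum as Sum using (_⊎_; inj₁; inj₂)
open import Data.Vec using (tabulate)
open import Data.Vec.Properties using (≡-dec; lookup∘tabulate; lookup⇒[]=; []=⇒lookup)
open import Function.Base using (_∘_; id)
open import Function.Bundles using (_⇔_; mk⇔; Equivalence)
open import Relation.Binary.Definitions using (Reflexive; Transitive)
open import Relation.Binary.PropositionalEquality
open import Relation.Nullary using (¬_; Dec; yes; no)
open import Relation.Nullary.Decidable
  using (does; dec-true; decidable-stable; _×-dec_; _→-dec_; _⊎-dec_; ¬?)
open import Relation.Unary using (Decidable)

-- The ancestor order and lca on positions

⪯-refl : ∀ p → p ⪯ p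
⪯-refl []      = []
⪯-refl (a ∷ p) = a ∷ ⪯-refl p

⪯-trans : ∀ {p q r} → p ⪯ q → q ⪯ r → p ⪯ r
⪯-trans _         []         = []
⪯-trans (a ∷ p⪯q) (.a ∷ q⪯r) = a ∷ ⪯-trans p⪯q q⪯r

⪯-total : ∀ {p q r} → p ⪯ q → p ⪯ r → q ⪯ r ⊎ r ⪯ q
⪯-total []        _          = inj₂ []
⪯-total (a ∷ _)   []         = inj₁ []
⪯-total (a ∷ p⪯q) (.a ∷ p⪯r) with ⪯-total p⪯q p⪯r
... | inj₁ q⪯r = inj₁ (a ∷ q⪯r)
... | inj₂ r⪯q = inj₂ (a ∷ r⪯q)

⪯-∷⁻ : ∀ {a b p q} → (a ∷ p) ⪯ (b ∷ q) → a ≡ b × p ⪯ q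
⪯-∷⁻ (_ ∷ p⪯q) = refl , p⪯q

lca-∷ : ∀ a p q → lca (a ∷ p) (a ∷ q) ≡ a ∷ lca p q
lca-∷ a p q with a ≟ a
... | yes _  = refl
... | no a≢a = ⊥-elim (a≢a refl)

lca-∷-≢ : ∀ {a b} p q → a ≢ b → lca (a ∷ p) (b ∷ q) ≡ []
lca-∷-≢ {a} {b} p q a≢b with a ≟ b
... | yes a≡b = ⊥-elim (a≢b a≡b)
... | no _    = refl

lca-comm : ∀ p q → lca p q ≡ lca q p
lca-comm []      []      = refl
lca-comm []      (b ∷ q) = refl
lca-comm (a ∷ p) []      = refl
lca-comm (a ∷ p) (b ∷ q) with a ≟ b
... | yes refl = trans (cong (a ∷_) (lca-comm p q)) (sym (lca-∷ a q p))
... | no a≢b   = sym (lca-∷-≢ q p (≢-sym a≢b))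

lca-idem : ∀ p → lca p p ≡ p
lca-idem []      = refl
lca-idem (a ∷ p) = trans (lca-∷ a p p) (cong (a ∷_) (lca-idem p))

⪯-lcaˡ : ∀ p q → p ⪯ lca p q
⪯-lcaˡ []      q       = []
⪯-lcaˡ (a ∷ p) []      = []
⪯-lcaˡ (a ∷ p) (b ∷ q) with a ≟ b
... | yes _ = a ∷ ⪯-lcaˡ p q
... | no  _ = []

⪯-lcaʳ : ∀ p q → q ⪯ lca p q
⪯-lcaʳ p q rewrite lca-comm p q = ⪯-lcaˡ q p

lca-least : ∀ {p q r} → p ⪯ r → q ⪯ r → lca p q ⪯ r
lca-least [] _ = []
lca-least {a ∷ p} {a ∷ q} (a ∷ p⪯r) (.a ∷ q⪯r) rewrite lca-∷ a p q = a ∷ lca-least p⪯r q⪯r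

≢-≢⇒≡ : ∀ {a b c : Fin 2} → a ≢ b → b ≢ c → a ≡ c
≢-≢⇒≡ {zero}     {zero}     a≢b _   = ⊥-elim (a≢b refl)
≢-≢⇒≡ {suc zero} {suc zero} a≢b _   = ⊥-elim (a≢b refl)
≢-≢⇒≡ {zero}     {suc zero} {zero}     _ _ = refl
≢-≢⇒≡ {suc zero} {zero}     {suc zero} _ _ = refl
≢-≢⇒≡ {zero}     {suc zero} {suc zero} _ b≢c = ⊥-elim (b≢c refl)
≢-≢⇒≡ {suc zero} {zero}     {zero}     _ b≢c = ⊥-elim (b≢c refl)

-- Necessity

module QuasiBestMatchGraph {n} {G : Digraph n} {σ : Coloring n} {pos : Fin n → Pos}
  {u : Fin n → Fin 2 → Pos} (arc⇔qbm : ∀ x y → Arc G x y ⇔ QuasiBestMatch pos σ u x y) where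

  lca⟨_,_⟩ : Fin n → Fin n → Pos
  lca⟨ x , y ⟩ = lca (pos x) (pos y)

  arc-colours : ∀ {x y} → Arc G x y → σ x ≢ σ y
  arc-colours {x} {y} xy = proj₁ (proj₁ (Equivalence.to (arc⇔qbm x y) xy))

  arc-best : ∀ {x y} → Arc G x y → ∀ y′ → σ y′ ≡ σ y → lca⟨ x , y ⟩ ⪯ lca⟨ x , y′ ⟩
  arc-best {x} {y} xy = proj₂ (proj₁ (Equivalence.to (arc⇔qbm x y) xy))

  arc-truncation : ∀ {x y} → Arc G x y → lca⟨ x , y ⟩ ⪯ u x (σ y)
  arc-truncation {x} {y} xy = proj₂ (Equivalence.to (arc⇔qbm x y) xy)

  arc-towards : ∀ {x a y} → Arc G x a → σ a ≡ σ y → lca⟨ x , y ⟩ ⪯ lca⟨ x , a ⟩ → Arc G x y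
  arc-towards {x} {a} {y} xa a~y y⪯a = Equivalence.from (arc⇔qbm x y)
    ((colours , best) , subst (λ s → lca⟨ x , y ⟩ ⪯ u x s) a~y (⪯-trans y⪯a (arc-truncation xa)))
    where
    colours : σ x ≢ σ y
    colours x~y = arc-colours xa (trans x~y (sym a~y))
    best : ∀ y′ → σ y′ ≡ σ y → lca⟨ x , y ⟩ ⪯ lca⟨ x , y′ ⟩
    best y′ y′~y = ⪯-trans y⪯a (arc-best xa y′ (trans y′~y (sym a~y)))

  arc-other-colour : ∀ {x y w} → Arc G x y → σ x ≢ σ w → σ y ≡ σ w
  arc-other-colour xy x≁w = ≢-≢⇒≡ (≢-sym (arc-colours xy)) x≁w

  arc-below-lca : ∀ {x y z} → Arc G y z → σ x ≡ σ z → pos z ⪯ lca⟨ x , y ⟩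
  arc-below-lca {x} {y} {z} yz x~z = ⪯-trans (⪯-lcaʳ (pos y) (pos z))
    (subst (lca⟨ y , z ⟩ ⪯_) (lca-comm (pos y) (pos x)) (arc-best yz x x~z))

  n2 : N2 G
  n2 x z (b , (a , xa , ab) , bz) = arc-towards xa a~z (lca-least (⪯-lcaˡ (pos x) (pos a)) z⪯xa)
    where
    a~z : σ a ≡ σ z
    a~z = ≢-≢⇒≡ (arc-colours ab) (arc-colours bz)
    x~b : σ x ≡ σ b
    x~b = ≢-≢⇒≡ (arc-colours xa) (arc-colours ab)
    z⪯xa : pos z ⪯ lca⟨ x , a ⟩
    z⪯xa = subst (pos z ⪯_) (lca-comm (pos a) (pos x))
             (⪯-trans (arc-below-lca bz a~z) (arc-best ab x x~b))

  shared-target-N⊆ : ∀ {x y z} → Arc G x z → Arc G y z → lca⟨ y , z ⟩ ⪯ lca⟨ x , z ⟩ →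
                     ∀ w → Arc G y w → Arc G x w
  shared-target-N⊆ {x} {y} {z} xz yz yz⪯xz w yw =
    arc-towards xz z~w (lca-least (⪯-lcaˡ (pos x) (pos z)) w⪯xz)
    where
    z~w : σ z ≡ σ w
    z~w = ≢-≢⇒≡ (≢-sym (arc-colours yz)) (arc-colours yw)
    w⪯xz : pos w ⪯ lca⟨ x , z ⟩
    w⪯xz = ⪯-trans (⪯-lcaʳ (pos y) (pos w)) (⪯-trans (arc-best yw z z~w) yz⪯xz)

  n3 : N3 G
  n3 x y (z , xz , yz) with ⪯-total (⪯-lcaʳ (pos x) (pos z)) (⪯-lcaʳ (pos y) (pos z))
  ... | inj₁ xz⪯yz = inj₁ (shared-target-N⊆ yz xz xz⪯yz)
  ... | inj₂ yz⪯xz = inj₂ (shared-target-N⊆ xz yz yz⪯xz)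

  independent-N∩NN : ∀ {x y z w} → ¬ Arc G y x → ¬ Arc G x y →
                     Arc G x z → Arc G y w → Arc G w z → ⊥
  independent-N∩NN {x} {y} {z} {w} ¬yx ¬xy xz yw wz with σ x ≟ᶠ σ y
  ... | yes x~y = arc-colours wz (≢-≢⇒≡ (λ w~x → arc-colours yw (sym (trans w~x x~y)))
                                        (arc-colours xz))
  ... | no x≁y
    with ⪯-total (⪯-lcaʳ (pos x) (pos z)) (arc-below-lca wz (sym (arc-other-colour xz x≁y)))
  ... | inj₁ xz⪯yw = ¬yx (arc-towards yw (arc-other-colour yw (≢-sym x≁y))
                          (lca-least (⪯-lcaˡ (pos y) (pos w)) (⪯-trans (⪯-lcaˡ (pos x) (pos z)) xz⪯yw)))
  ... | inj₂ yw⪯xz = ¬xy (arc-towards xz (arc-other-colour xz x≁y)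
                          (lca-least (⪯-lcaˡ (pos x) (pos z)) (⪯-trans (⪯-lcaˡ (pos y) (pos w)) yw⪯xz)))

  n1 : N1 G
  n1 x y ¬yx ¬xy = (λ z (xz , w , yw , wz) → independent-N∩NN ¬yx ¬xy xz yw wz)
                 , (λ z (yz , w , xw , wz) → independent-N∩NN ¬xy ¬yx yz xw wz)

qBMG⇒N1∧N2∧N3 : ∀ {n} {G : Digraph n} {σ : Coloring n} → qBMG G σ → N1 G × N2 G × N3 G
qBMG⇒N1∧N2∧N3 {G = G} {σ} (_ , _ , pos , _ , u , _ , arc⇔qbm) = n1 , n2 , n3
  where open QuasiBestMatchGraph {G = G} {σ} {pos} {u} arc⇔qbm

-- The tree of a hierarchy

module _ {A : Set} {_≤_ : A → A → Set} (≤-refl : Reflexive _≤_) (≤-trans : Transitive _≤_) where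

  chain-maximum : ∀ {P : A → Set} → Decidable P → ∀ xs →
                  (∀ {a b} → a ∈ᴸ xs → b ∈ᴸ xs → P a → P b → a ≤ b ⊎ b ≤ a) → Any P xs →
                  ∃[ m ] m ∈ᴸ xs × P m × (∀ {b} → b ∈ᴸ xs → P b → b ≤ m)
  chain-maximum P? (x ∷ xs) comparable any with Any.any? P? xs
  chain-maximum P? (x ∷ xs) comparable (here px) | no ¬any =
    x , here refl , px , λ { (here refl) _ → ≤-refl ; (there b∈) pb → ⊥-elim (¬any (lose b∈ pb)) }
  chain-maximum P? (x ∷ xs) comparable (there any) | no ¬any = ⊥-elim (¬any any)
  chain-maximum P? (x ∷ xs) comparable _ | yes any
    with chain-maximum P? xs (λ a∈ b∈ → comparable (there a∈) (there b∈)) any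
  ... | m , m∈ , pm , m-max with P? x
  ...   | no ¬px = m , there m∈ , pm , λ { (here refl) px → ⊥-elim (¬px px) ; (there b∈) → m-max b∈ }
  ...   | yes px with comparable (here refl) (there m∈) px pm
  ...     | inj₁ x≤m = m , there m∈ , pm , λ { (here refl) _ → x≤m ; (there b∈) → m-max b∈ }
  ...     | inj₂ m≤x = x , here refl , px ,
                       λ { (here refl) _ → ≤-refl ; (there b∈) pb → ≤-trans (m-max b∈ pb) m≤x }

lookup-injective : ∀ {A : Set} {xs : List A} → Unique xs → ∀ i j → lookup xs i ≡ lookup xs j → i ≡ j
lookup-injective (_ ∷ _)      zero    zero    _  = refl
lookup-injective (x∉xs ∷ _)   zero    (suc j) eq = ⊥-elim (All.lookup x∉xs (∈-lookup j) eq)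
lookup-injective (x∉xs ∷ _)   (suc i) zero    eq = ⊥-elim (All.lookup x∉xs (∈-lookup i) (sym eq))
lookup-injective (_ ∷ unique) (suc i) (suc j) eq = cong suc (lookup-injective unique i j eq)

distinct⇒2≤ : ∀ {m} {i j : Fin m} → i ≢ j → 2 ≤ m
distinct⇒2≤ {suc (suc _)} _                = s≤s (s≤s z≤n)
distinct⇒2≤ {suc zero} {zero} {zero} i≢j = ⊥-elim (i≢j refl)

module _ {n} {A : Set} (g : A → Tree n) where

  LeafAt-map⁺ : ∀ xs i {p x} → LeafAt (g (lookup xs i)) p x → LeafAt (node (map g xs)) (toℕ i ∷ p) x
  LeafAt-map⁺ (a ∷ xs) zero    l = there zero l
  LeafAt-map⁺ (a ∷ xs) (suc i) l = there-suc (LeafAt-map⁺ xs i l)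
    where
    there-suc : ∀ {t ts k p x} → LeafAt (node ts) (k ∷ p) x → LeafAt (node (t ∷ ts)) (suc k ∷ p) x
    there-suc (there j l′) = there (suc j) l′

  LeafAt-map⁻ : ∀ xs {k p x} → LeafAt (node (map g xs)) (k ∷ p) x →
                ∃[ i ] toℕ i ≡ k × LeafAt (g (lookup xs i)) p x
  LeafAt-map⁻ (a ∷ xs) (there zero    l) = zero , refl , l
  LeafAt-map⁻ (a ∷ xs) (there (suc j) l) with LeafAt-map⁻ xs (there j l)
  ... | i , i≡j , l′ = suc i , cong suc i≡j , l′

_≟ˢ_ : ∀ {n} (p q : Subset n) → Dec (p ≡ q)
_≟ˢ_ = ≡-dec _≟ᵇ_

⟦_⟧ : ∀ {n} {P : Fin n → Set} → Decidable P → Subset n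
⟦ P? ⟧ = tabulate (does ∘ P?)

module _ {n} {P : Fin n → Set} (P? : Decidable P) where

  ∈⟦⟧⁺ : ∀ {x} → P x → x ∈ ⟦ P? ⟧
  ∈⟦⟧⁺ {x} px = lookup⇒[]= x ⟦ P? ⟧ (trans (lookup∘tabulate (does ∘ P?) x) (dec-true (P? x) px))

  ∈⟦⟧⁻ : ∀ {x} → x ∈ ⟦ P? ⟧ → P x
  ∈⟦⟧⁻ {x} x∈ with P? x | trans (sym (lookup∘tabulate (does ∘ P?) x)) ([]=⇒lookup x∈)
  ... | yes px | _  = px
  ... | no _   | ()

module Hierarchy {n : ℕ} (𝒞 : List (Subset n))
  (laminar : ∀ {C D x} → C ∈ᴸ 𝒞 → D ∈ᴸ 𝒞 → x ∈ C → x ∈ D → C ⊆ D ⊎ D ⊆ C)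
  (⊤∈𝒞 : ⊤ ∈ᴸ 𝒞) (⁅⁆∈𝒞 : ∀ x → ⁅ x ⁆ ∈ᴸ 𝒞) where

  _∈⟨_,_⟩ : Fin n → Fin n → Fin n → Set
  z ∈⟨ x , y ⟩ = ∀ {C} → C ∈ᴸ 𝒞 → x ∈ C → y ∈ C → z ∈ C

  Nontrivial : Subset n → Set
  Nontrivial S = ∃[ a ] ∃[ b ] a ∈ S × b ∈ S × a ≢ b

  nontrivial? : Decidable Nontrivial
  nontrivial? S = any? λ a → any? λ b → a ∈? S ×-dec b ∈? S ×-dec ¬? (a ≟ᶠ b)

  MaximalIn : Subset n → Subset n → Set
  MaximalIn S C = C ⊂ S × Nonempty C × All (λ D → C ⊆ D → D ⊂ S → D ⊆ C) 𝒞

  maximalIn? : ∀ S → Decidable (MaximalIn S)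
  maximalIn? S C =
    C ⊂? S ×-dec nonempty? C ×-dec All.all? (λ D → C ⊆? D →-dec D ⊂? S →-dec D ⊆? C) 𝒞

  -- 𝒞 may list a cluster more than once; a duplicated child would give its leaves two positions.
  children : Subset n → List (Subset n)
  children S = deduplicate _≟ˢ_ (filter (maximalIn? S) 𝒞)

  child : ∀ S → Fin (length (children S)) → Subset n
  child S = lookup (children S)

  module _ {S C : Subset n} (C∈ : C ∈ᴸ children S) where

    private
      child∈filter : C ∈ᴸ 𝒞 × MaximalIn S C
      child∈filter = ∈-filter⁻ (maximalIn? S) {xs = 𝒞}
                       (∈-deduplicate⁻ _≟ˢ_ (filter (maximalIn? S) 𝒞) C∈)

    child∈𝒞 : C ∈ᴸ 𝒞
    child∈𝒞 = proj₁ child∈filter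

    child-maximal : MaximalIn S C
    child-maximal = proj₂ child∈filter

    child⊂ : C ⊂ S
    child⊂ = proj₁ child-maximal

  proper-subcluster⊆child : ∀ {S C D x} → C ∈ᴸ 𝒞 → C ⊂ S → D ∈ᴸ children S → x ∈ C → x ∈ D → C ⊆ D
  proper-subcluster⊆child C∈𝒞 C⊂S D∈ x∈C x∈D with laminar C∈𝒞 (child∈𝒞 D∈) x∈C x∈D
  ... | inj₁ C⊆D = C⊆D
  ... | inj₂ D⊆C = All.lookup (proj₂ (proj₂ (child-maximal D∈))) C∈𝒞 D⊆C C⊂S

  children-disjoint : ∀ {S C D x} → C ∈ᴸ children S → D ∈ᴸ children S → x ∈ C → x ∈ D → C ≡ D
  children-disjoint C∈ D∈ x∈C x∈D =
    ⊆-antisym (proper-subcluster⊆child (child∈𝒞 C∈) (child⊂ C∈) D∈ x∈C x∈D)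
              (proper-subcluster⊆child (child∈𝒞 D∈) (child⊂ D∈) C∈ x∈D x∈C)

  child-index-unique : ∀ {S x} i j → x ∈ child S i → x ∈ child S j → i ≡ j
  child-index-unique {S} i j x∈i x∈j =
    lookup-injective (UniqueDec.deduplicate-! _≟ˢ_ (filter (maximalIn? S) 𝒞)) i j
    (children-disjoint (∈-lookup {xs = children S} i) (∈-lookup j) x∈i x∈j)

  ⁅⁆⊂ : ∀ {S x} → Nontrivial S → x ∈ S → ⁅ x ⁆ ⊂ S
  ⁅⁆⊂ {S} {x} (a , b , a∈ , b∈ , a≢b) x∈ =
    (λ y∈⁅x⁆ → subst (_∈ S) (sym (x∈⁅y⁆⇒x≡y x y∈⁅x⁆)) x∈) , outside
    where
    outside : ∃[ w ] w ∈ S × w ∉ ⁅ x ⁆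
    outside with a ≟ᶠ x
    ... | yes refl = b , b∈ , λ b∈⁅a⁆ → a≢b (sym (x∈⁅y⁆⇒x≡y a b∈⁅a⁆))
    ... | no a≢x   = a , a∈ , λ a∈⁅x⁆ → a≢x (x∈⁅y⁆⇒x≡y x a∈⁅x⁆)

  child-containing : ∀ {S x} → Nontrivial S → x ∈ S → Any (x ∈_) (children S)
  child-containing {S} {x} nt x∈S
    with chain-maximum {_≤_ = _⊆_} (λ {p} → ⊆-refl {x = p}) ⊆-trans (λ C → x ∈? C ×-dec C ⊂? S) 𝒞
           (λ C∈ D∈ (x∈C , _) (x∈D , _) → laminar C∈ D∈ x∈C x∈D)
           (lose (⁅⁆∈𝒞 x) (x∈⁅x⁆ x , ⁅⁆⊂ nt x∈S))
  ... | C , C∈𝒞 , (x∈C , C⊂S) , greatest =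
    lose (∈-deduplicate⁺ _≟ˢ_ (∈-filter⁺ (maximalIn? S) C∈𝒞 maximal)) x∈C
    where
    maximal : MaximalIn S C
    maximal = C⊂S , (x , x∈C) , All.tabulate (λ D∈ C⊆D D⊂S → greatest D∈ (C⊆D x∈C , D⊂S))

  child-index : ∀ {S x} → Nontrivial S → x ∈ S → ∃[ i ] x ∈ child S i
  child-index {S} {x} nt x∈S = index x∈C , lookup-index x∈C
    where
    x∈C : Any (x ∈_) (children S)
    x∈C = child-containing nt x∈S

  child⇒nontrivial : ∀ {S C} → C ∈ᴸ children S → Nontrivial S
  child⇒nontrivial C∈ with child-maximal C∈
  ... | (C⊆S , w , w∈S , w∉C) , (y , y∈C) , _ =
    y , w , C⊆S y∈C , w∈S , λ { refl → w∉C y∈C }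

  position : ℕ → Subset n → Fin n → Pos
  position zero    S x = []
  position (suc f) S x with Any.any? (x ∈?_) (children S)
  ... | yes x∈C = toℕ (index x∈C) ∷ position f (child S (index x∈C)) x
  ... | no  _   = []

  -- The cases node [] are junk: they are never reached from a nonempty S with ∣ S ∣ ≤ f.
  tree : ℕ → Subset n → Tree n
  tree zero    S = node []
  tree (suc f) S with nontrivial? S | nonempty? S
  ... | yes _ | _           = node (map (tree f) (children S))
  ... | no _  | yes (x , _) = leaf x
  ... | no _  | no _        = node []

  position-∷ : ∀ {S x f} i → x ∈ child S i → position (suc f) S x ≡ toℕ i ∷ position f (child S i) x
  position-∷ {S} {x} i x∈i with Any.any? (x ∈?_) (children S)
  ... | no x∉ = ⊥-elim (x∉ (lose (∈-lookup i) x∈i))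
  ... | yes x∈C with child-index-unique (index x∈C) i (lookup-index x∈C) x∈i
  ...   | refl = refl

  position-[] : ∀ {S x f} → ¬ Nontrivial S → position (suc f) S x ≡ []
  position-[] {S} {x} ¬nt with Any.any? (x ∈?_) (children S)
  ... | yes x∈C = ⊥-elim (¬nt (child⇒nontrivial (∈-lookup {xs = children S} (index x∈C))))
  ... | no _    = refl

  child-fuel : ∀ {S C f} → C ∈ᴸ children S → ∣ S ∣ ≤ suc f → ∣ C ∣ ≤ f
  child-fuel C∈ S≤ = m<1+n⇒m≤n (<-≤-trans (p⊂q⇒∣p∣<∣q∣ (child⊂ C∈)) S≤)

  empty-without-fuel : ∀ {S : Subset n} {x} → ∣ S ∣ ≤ 0 → x ∉ S
  empty-without-fuel {S} {x} S≤0 x∈ with <-≤-trans (p⊂q⇒∣p∣<∣q∣ {p = ∅} (⊥⊆ , x , x∈ , ∉⊥)) S≤0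
  ... | ()

  leaf-position : ∀ {S x} f → ∣ S ∣ ≤ f → x ∈ S → LeafAt (tree f S) (position f S x) x
  leaf-position zero S≤ x∈ = ⊥-elim (empty-without-fuel S≤ x∈)
  leaf-position {S} {x} (suc f) S≤ x∈ with nontrivial? S | nonempty? S
  ... | yes nt | _ with child-index nt x∈
  ...   | i , x∈i rewrite position-∷ {f = f} i x∈i =
    LeafAt-map⁺ (tree f) (children S) i (leaf-position f (child-fuel (∈-lookup i) S≤) x∈i)
  leaf-position {S} {x} (suc f) S≤ x∈ | no ¬nt | yes (w , w∈) rewrite position-[] {S} {x} {f} ¬nt
    with x ≟ᶠ w
  ... | yes refl = here x
  ... | no x≢w   = ⊥-elim (¬nt (x , w , x∈ , w∈ , x≢w))
  leaf-position {S} {x} (suc f) S≤ x∈ | no _ | no ¬ne = ⊥-elim (¬ne (x , x∈))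

  leaf-member : ∀ {S p x} f → LeafAt (tree f S) p x → x ∈ S
  leaf-member zero (there () _)
  leaf-member {S} (suc f) l with nontrivial? S | nonempty? S
  leaf-member {S} (suc f) (there j l) | yes nt | _ with LeafAt-map⁻ (tree f) (children S) (there j l)
  ... | i , _ , l′ = proj₁ (child⊂ (∈-lookup i)) (leaf-member f l′)
  leaf-member {S} (suc f) (here _)     | no _ | yes (_ , w∈) = w∈
  leaf-member {S} (suc f) (there () _) | no _ | no _

  leaf-unique : ∀ {S p x} f → ∣ S ∣ ≤ f → LeafAt (tree f S) p x → p ≡ position f S x
  leaf-unique zero _ (there () _)
  leaf-unique {S} (suc f) S≤ l with nontrivial? S | nonempty? S
  leaf-unique {S} {x = x} (suc f) S≤ (there j l) | yes nt | _
    with LeafAt-map⁻ (tree f) (children S) (there j l)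
  ... | i , i≡j , l′ = begin
    toℕ j ∷ _
      ≡⟨ cong₂ _∷_ (sym i≡j) (leaf-unique f (child-fuel (∈-lookup i) S≤) l′) ⟩
    toℕ i ∷ position f (child S i) x
      ≡⟨ position-∷ i (leaf-member f l′) ⟨
    position (suc f) S x
      ∎
    where open ≡-Reasoning
  leaf-unique {S} (suc f) S≤ (here _)     | no ¬nt | yes _ = sym (position-[] ¬nt)
  leaf-unique {S} (suc f) S≤ (there () _) | no _   | no _

  two-children : ∀ {S} → Nontrivial S → 2 ≤ length (children S)
  two-children nt@(a , _ , a∈ , _) with child-index nt a∈
  ... | i , a∈i with child⊂ (∈-lookup i)
  ...   | _ , w , w∈ , w∉i with child-index nt w∈
  ...     | j , w∈j = distinct⇒2≤ {i = i} {j} λ { refl → w∉i w∈j }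

  tree-phylo : ∀ {S} f → ∣ S ∣ ≤ f → Nonempty S → Phylo (tree f S)
  tree-phylo zero S≤ (x , x∈) = ⊥-elim (empty-without-fuel S≤ x∈)
  tree-phylo {S} (suc f) S≤ (x , x∈) with nontrivial? S | nonempty? S
  ... | yes nt | _ = nodeP (subst (2 ≤_) (sym (length-map (tree f) (children S))) (two-children nt))
    (map⁺ (All.tabulate λ C∈ → tree-phylo f (child-fuel C∈ S≤) (proj₁ (proj₂ (child-maximal C∈)))))
  ... | no _ | yes (w , _) = leafP w
  ... | no _ | no ¬ne = ⊥-elim (¬ne (x , x∈))

  trivial⇒≡ : ∀ {S x z} → ¬ Nontrivial S → x ∈ S → z ∈ S → z ≡ x
  trivial⇒≡ {x = x} {z} ¬nt x∈ z∈ with z ≟ᶠ x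
  ... | yes z≡x = z≡x
  ... | no z≢x  = ⊥-elim (¬nt (z , x , z∈ , x∈ , z≢x))

  spans-across-children : ∀ {S x y z} {i j} → S ∈ᴸ 𝒞 → z ∈ S →
                          x ∈ child S i → y ∈ child S j → i ≢ j → z ∈⟨ x , y ⟩
  spans-across-children {S} {y = y} {z} {i} {j} S∈𝒞 z∈S x∈i y∈j i≢j {C} C∈𝒞 x∈C y∈C
    with laminar C∈𝒞 S∈𝒞 x∈C (proj₁ (child⊂ (∈-lookup i)) x∈i)
  ... | inj₂ S⊆C = S⊆C z∈S
  ... | inj₁ C⊆S with z ∈? C
  ...   | yes z∈C = z∈C
  ...   | no z∉C  = ⊥-elim (i≢j (child-index-unique i j y∈i y∈j))
    where
    y∈i : y ∈ child S i
    y∈i = proper-subcluster⊆child C∈𝒞 (C⊆S , z , z∈S , z∉C) (∈-lookup i) x∈C x∈i y∈C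

  lca-position-same : ∀ {S x y f} i → x ∈ child S i → y ∈ child S i →
                      lca (position (suc f) S x) (position (suc f) S y)
                      ≡ toℕ i ∷ lca (position f (child S i) x) (position f (child S i) y)
  lca-position-same {f = f} i x∈i y∈i
    rewrite position-∷ {f = f} i x∈i | position-∷ {f = f} i y∈i = lca-∷ (toℕ i) _ _

  lca-position-different : ∀ {S x y f} i j → x ∈ child S i → y ∈ child S j → i ≢ j →
                           lca (position (suc f) S x) (position (suc f) S y) ≡ []
  lca-position-different {f = f} i j x∈i y∈j i≢j
    rewrite position-∷ {f = f} i x∈i | position-∷ {f = f} j y∈j = lca-∷-≢ _ _ (i≢j ∘ toℕ-injective)

  below-lca⇒spans : ∀ {S x y z} f → S ∈ᴸ 𝒞 → ∣ S ∣ ≤ f → x ∈ S → y ∈ S → z ∈ S →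
                    position f S z ⪯ lca (position f S x) (position f S y) → z ∈⟨ x , y ⟩
  below-lca⇒spans zero _ S≤ x∈ _ _ _ = ⊥-elim (empty-without-fuel S≤ x∈)
  below-lca⇒spans {S} {x} {y} {z} (suc f) S∈𝒞 S≤ x∈ y∈ z∈ z⪯xy with nontrivial? S
  ... | no ¬nt rewrite trivial⇒≡ ¬nt x∈ z∈ = λ _ x∈C _ → x∈C
  ... | yes nt with child-index nt x∈ | child-index nt y∈ | child-index nt z∈
  ...   | i , x∈i | j , y∈j | k , z∈k with i ≟ᶠ j
  ...     | no i≢j   = spans-across-children S∈𝒞 z∈ x∈i y∈j i≢j
  ...     | yes refl
    with ⪯-∷⁻ (subst₂ _⪯_ (position-∷ k z∈k) (lca-position-same i x∈i y∈j) z⪯xy)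
  ...       | k≡i , z⪯xy′ with toℕ-injective k≡i
  ...         | refl = below-lca⇒spans f (child∈𝒞 (∈-lookup i)) (child-fuel (∈-lookup i) S≤)
                                       x∈i y∈j z∈k z⪯xy′

  spans⇒below-lca : ∀ {S x y z} f → ∣ S ∣ ≤ f → x ∈ S → y ∈ S → z ∈ S →
                    z ∈⟨ x , y ⟩ → position f S z ⪯ lca (position f S x) (position f S y)
  spans⇒below-lca zero S≤ x∈ _ _ _ = ⊥-elim (empty-without-fuel S≤ x∈)
  spans⇒below-lca {S} {x} {y} {z} (suc f) S≤ x∈ y∈ z∈ z∈xy with nontrivial? S
  ... | no ¬nt rewrite position-[] {S} {x} {f} ¬nt = []
  ... | yes nt with child-index nt x∈ | child-index nt y∈
  ...   | i , x∈i | j , y∈j with i ≟ᶠ j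
  ...     | no i≢j rewrite lca-position-different {f = f} i j x∈i y∈j i≢j = []
  ...     | yes refl with z∈xy (child∈𝒞 (∈-lookup i)) x∈i y∈j
  ...       | z∈i rewrite position-∷ {f = f} i z∈i | lca-position-same {f = f} i x∈i y∈j =
    toℕ i ∷ spans⇒below-lca f (child-fuel (∈-lookup i) S≤) x∈i y∈j z∈i z∈xy

  pos : Fin n → Pos
  pos = position n ⊤

  𝒯 : Tree n
  𝒯 = tree n ⊤

  below-lca⇔spans : ∀ {x y z} → pos z ⪯ lca (pos x) (pos y) ⇔ z ∈⟨ x , y ⟩
  below-lca⇔spans = mk⇔ (below-lca⇒spans n ⊤∈𝒞 (∣p∣≤n ⊤) ∈⊤ ∈⊤ ∈⊤)
                        (spans⇒below-lca n (∣p∣≤n ⊤) ∈⊤ ∈⊤ ∈⊤)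

  𝒯-leaves : LeafBij 𝒯 pos
  𝒯-leaves = (λ _ → leaf-position n (∣p∣≤n ⊤) ∈⊤) , (λ _ _ → leaf-unique n (∣p∣≤n ⊤))

  𝒯-phylogenetic : Fin n → Phylo 𝒯
  𝒯-phylogenetic x = tree-phylo n (∣p∣≤n ⊤) (x , ∈⊤)

-- Sufficiency

module Clusters {n} {G : Digraph n} {σ : Coloring n}
  (proper : Proper G σ) (n1 : N1 G) (n2 : N2 G) (n3 : N3 G) where

  arc? : ∀ x y → Dec (Arc G x y)
  arc? x y = E G x y ≟ᵇ true

  arc-colours : ∀ {x y} → Arc G x y → σ x ≢ σ y
  arc-colours {x} {y} xy x~y = proj₁ (proper x y x~y) xy

  HasOut : Fin n → Set
  HasOut x = ∃ (Arc G x)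

  hasOut? : Decidable HasOut
  hasOut? x = any? (arc? x)

  N[_]⊆N[_] : Fin n → Fin n → Set
  N[ y ]⊆N[ v ] = ∀ z → Arc G y z → Arc G v z

  N⊆? : ∀ y v → Dec N[ y ]⊆N[ v ]
  N⊆? y v = all? (λ z → arc? y z →-dec arc? v z)

  InK : Fin n → Fin n → Set
  InK x y = Arc G x y ⊎ (σ y ≡ σ x × (InNN G x y ⊎ (HasOut y × N[ y ]⊆N[ x ])))

  inK? : ∀ x → Decidable (InK x)
  inK? x y = arc? x y ⊎-dec (σ y ≟ᶠ σ x ×-dec
               (any? (λ w → arc? x w ×-dec arc? w y) ⊎-dec (hasOut? y ×-dec N⊆? y x)))

  _⊑_ : Fin n → Fin n → Set
  x ⊑ v = ∀ {y} → InK x y → InK v y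

  InK-self : ∀ {x} → HasOut x → InK x x
  InK-self out = inj₂ (refl , inj₂ (out , λ _ xz → xz))

  N²-out⊆ : ∀ {x w} → InNN G x w → N[ w ]⊆N[ x ]
  N²-out⊆ xw z wz = n2 _ z (_ , xw , wz)

  InK-arc : ∀ {v x y} → Arc G x y → InK v x → InK v y
  InK-arc xy (inj₁ vx) =
    inj₂ (≢-≢⇒≡ (≢-sym (arc-colours xy)) (≢-sym (arc-colours vx)) , inj₁ (_ , vx , xy))
  InK-arc xy (inj₂ (_ , inj₁ vx))         = inj₁ (N²-out⊆ vx _ xy)
  InK-arc xy (inj₂ (_ , inj₂ (_ , N⊆))) = inj₁ (N⊆ _ xy)

  common-N²⇒common-N : ∀ {x v w} → InNN G x w → InNN G v w → ∃[ z ] Arc G x z × Arc G v z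
  common-N²⇒common-N {x} (a , xa , aw) (b , vb , bw) with arc? x b | arc? b x
  ... | yes xb | _      = b , xb , vb
  ... | no _   | yes bx = a , xa , N²-out⊆ (b , vb , bx) a xa
  ... | no ¬xb | no ¬bx = ⊥-elim (proj₂ (n1 x b ¬bx ¬xb) _ (bw , a , xa , aw))

  ⊑-of-N⊆ : ∀ {x v} → σ x ≡ σ v → N[ x ]⊆N[ v ] → x ⊑ v
  ⊑-of-N⊆ x~v N⊆ (inj₁ xy)                        = inj₁ (N⊆ _ xy)
  ⊑-of-N⊆ x~v N⊆ (inj₂ (y~x , inj₁ (a , xa , ay))) = inj₂ (trans y~x x~v , inj₁ (a , N⊆ a xa , ay))
  ⊑-of-N⊆ x~v N⊆ (inj₂ (y~x , inj₂ (out , N⊆′)))   =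
    inj₂ (trans y~x x~v , inj₂ (out , λ z yz → N⊆ z (N⊆′ z yz)))

  same-colour-K-overlap : ∀ {x v w} → σ x ≡ σ v → InK x w → InK v w → ∃[ z ] Arc G x z × Arc G v z
  same-colour-K-overlap _ (inj₁ xw) (inj₁ vw) = _ , xw , vw
  same-colour-K-overlap x~v (inj₁ xw) (inj₂ (w~v , _)) = ⊥-elim (arc-colours xw (trans x~v (sym w~v)))
  same-colour-K-overlap x~v (inj₂ (w~x , _)) (inj₁ vw) = ⊥-elim (arc-colours vw (trans (sym x~v) (sym w~x)))
  same-colour-K-overlap _ (inj₂ (_ , inj₁ xw)) (inj₂ (_ , inj₁ vw)) = common-N²⇒common-N xw vw
  same-colour-K-overlap _ (inj₂ (_ , inj₁ xw)) (inj₂ (_ , inj₂ ((z , wz) , N⊆))) =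
    z , N²-out⊆ xw z wz , N⊆ z wz
  same-colour-K-overlap _ (inj₂ (_ , inj₂ ((z , wz) , N⊆))) (inj₂ (_ , inj₁ vw)) =
    z , N⊆ z wz , N²-out⊆ vw z wz
  same-colour-K-overlap _ (inj₂ (_ , inj₂ ((z , wz) , N⊆))) (inj₂ (_ , inj₂ (_ , N⊆′))) =
    z , N⊆ z wz , N⊆′ z wz

  K-laminar-same-colour : ∀ {x v w} → σ x ≡ σ v → InK x w → InK v w → x ⊑ v ⊎ v ⊑ x
  K-laminar-same-colour {x} {v} x~v xw vw with n3 x v (same-colour-K-overlap x~v xw vw)
  ... | inj₁ N⊆ = inj₁ (⊑-of-N⊆ x~v N⊆)
  ... | inj₂ N⊆ = inj₂ (⊑-of-N⊆ (sym x~v) N⊆)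

  arc-into-K-adjacent : ∀ {x v w} → Arc G x w → σ w ≡ σ v → InK v w → Arc G x v ⊎ Arc G v x
  arc-into-K-adjacent xw w~v (inj₁ vw) = ⊥-elim (arc-colours vw (sym w~v))
  arc-into-K-adjacent {x} {v} {w} xw _ (inj₂ (_ , vw)) with arc? x v | arc? v x
  ... | yes xv | _      = inj₁ xv
  ... | no _   | yes vx = inj₂ vx
  ... | no ¬xv | no ¬vx with vw
  ...   | inj₁ vw²               = ⊥-elim (proj₁ (n1 x v ¬vx ¬xv) w (xw , vw²))
  ...   | inj₂ ((z , wz) , N⊆) = ⊥-elim (proj₂ (n1 x v ¬vx ¬xv) z (N⊆ z wz , w , xw , wz))

  different-colour-K-overlap : ∀ {x v w} → σ x ≢ σ v → InK x w → InK v w → Arc G x v ⊎ Arc G v x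
  different-colour-K-overlap x≁v (inj₁ xw) vw =
    arc-into-K-adjacent xw (≢-≢⇒≡ (≢-sym (arc-colours xw)) x≁v) vw
  different-colour-K-overlap x≁v (inj₂ w~x) (inj₁ vw) = Sum.swap
    (arc-into-K-adjacent vw (≢-≢⇒≡ (≢-sym (arc-colours vw)) (≢-sym x≁v)) (inj₂ w~x))
  different-colour-K-overlap x≁v (inj₂ (w~x , _)) (inj₂ (w~v , _)) = ⊥-elim (x≁v (trans (sym w~x) w~v))

  Absorbs : Fin n → Fin n → Set
  Absorbs v x = ∀ y → σ y ≡ σ v → HasOut y → N[ y ]⊆N[ v ] → Arc G x y

  Unabsorbed : Fin n → Fin n → Fin n → Set
  Unabsorbed v x y = σ y ≡ σ v × HasOut y × N[ y ]⊆N[ v ] × ¬ Arc G x y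

  absorbs-or-unabsorbed : ∀ v x → Absorbs v x ⊎ ∃ (Unabsorbed v x)
  absorbs-or-unabsorbed v x
    with any? (λ y → σ y ≟ᶠ σ v ×-dec hasOut? y ×-dec N⊆? y v ×-dec ¬? (arc? x y))
  ... | yes unabsorbed = inj₂ unabsorbed
  ... | no ¬unabsorbed = inj₁ λ y y~v out N⊆ →
    decidable-stable (arc? x y) λ ¬xy → ¬unabsorbed (y , y~v , out , N⊆ , ¬xy)

  ⊑-of-absorbs : ∀ {x v} → σ x ≢ σ v → Absorbs v x → v ⊑ x
  ⊑-of-absorbs {x} {v} x≁v absorbs (inj₁ vy) =
    inj₂ (≢-≢⇒≡ (≢-sym (arc-colours vy)) (≢-sym x≁v)
         , inj₁ (v , absorbs v refl (_ , vy) (λ _ → id) , vy))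
  ⊑-of-absorbs {x} {v} x≁v absorbs (inj₂ (_ , inj₁ (a , va , ay))) =
    inj₁ (n2 x _ (a , (v , absorbs v refl (_ , va) (λ _ → id) , va) , ay))
  ⊑-of-absorbs x≁v absorbs (inj₂ (y~v , inj₂ (out , N⊆))) = inj₁ (absorbs _ y~v out N⊆)

  unabsorbed-back-arc : ∀ {x v y} → Arc G x v → Unabsorbed v x y → Arc G y x
  unabsorbed-back-arc {x} {v} {y} xv (_ , (z , yz) , N⊆ , ¬xy) with arc? y x
  ... | yes yx = yx
  ... | no ¬yx = ⊥-elim (proj₂ (n1 x y ¬yx ¬xy) z (yz , v , xv , N⊆ z yz))

  unabsorbed-reverse-arc : ∀ {x v y} → Arc G x v → Unabsorbed v x y → Arc G v x
  unabsorbed-reverse-arc xv bad@(_ , _ , N⊆ , _) = N⊆ _ (unabsorbed-back-arc xv bad)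

  unabsorbed-pair : ∀ {x v y y′} → Arc G x v → Arc G v x →
                    Unabsorbed v x y → Unabsorbed x v y′ → ⊥
  unabsorbed-pair {x} {v} {y} {y′} xv vx bad@(_ , _ , N⊆ , ¬xy) bad′@(_ , _ , N⊆′ , ¬vy′)
    with arc? y y′ | arc? y′ y
  ... | yes yy′ | _       = ¬vy′ (N⊆ y′ yy′)
  ... | no _    | yes y′y = ¬xy (N⊆′ y y′y)
  ... | no ¬yy′ | no ¬y′y = proj₁ (n1 y y′ ¬y′y ¬yy′) x
    (unabsorbed-back-arc xv bad , v , unabsorbed-back-arc vx bad′ , vx)

  K-laminar-different-colour : ∀ {x v w} → σ x ≢ σ v → InK x w → InK v w → x ⊑ v ⊎ v ⊑ x
  K-laminar-different-colour {x} {v} x≁v xw vw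
    with absorbs-or-unabsorbed v x | absorbs-or-unabsorbed x v
  ... | inj₁ absorbs | _            = inj₂ (⊑-of-absorbs x≁v absorbs)
  ... | inj₂ _       | inj₁ absorbs = inj₁ (⊑-of-absorbs (≢-sym x≁v) absorbs)
  ... | inj₂ (_ , bad) | inj₂ (_ , bad′) with different-colour-K-overlap x≁v xw vw
  ...   | inj₁ xv = ⊥-elim (unabsorbed-pair xv (unabsorbed-reverse-arc xv bad) bad bad′)
  ...   | inj₂ vx = ⊥-elim (unabsorbed-pair (unabsorbed-reverse-arc vx bad′) vx bad bad′)

  K-laminar : ∀ {x v w} → InK x w → InK v w → x ⊑ v ⊎ v ⊑ x
  K-laminar {x} {v} xw vw with σ x ≟ᶠ σ v
  ... | yes x~v = K-laminar-same-colour x~v xw vw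
  ... | no x≁v  = K-laminar-different-colour x≁v xw vw

  K : Fin n → Subset n
  K x = ⟦ inK? x ⟧

  ⊑⇒K⊆ : ∀ {x v} → x ⊑ v → K x ⊆ K v
  ⊑⇒K⊆ {x} {v} x⊑v y∈ = ∈⟦⟧⁺ (inK? v) (x⊑v (∈⟦⟧⁻ (inK? x) y∈))

  𝒞 : List (Subset n)
  𝒞 = ⊤ ∷ map ⁅_⁆ (allFin n) ++ map K (allFin n)

  data Cluster : Subset n → Set where
    whole     : Cluster ⊤
    singleton : ∀ x → Cluster ⁅ x ⁆
    K-of      : ∀ x → Cluster (K x)

  cluster : ∀ {C} → C ∈ᴸ 𝒞 → Cluster C
  cluster (here refl) = whole
  cluster (there C∈) with ∈-++⁻ (map ⁅_⁆ (allFin n)) C∈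
  ... | inj₁ C∈⁅⁆ with ∈-map⁻ ⁅_⁆ C∈⁅⁆
  ...   | x , _ , refl = singleton x
  cluster (there C∈) | inj₂ C∈K with ∈-map⁻ K C∈K
  ...   | x , _ , refl = K-of x

  ⁅⁆∈𝒞 : ∀ x → ⁅ x ⁆ ∈ᴸ 𝒞
  ⁅⁆∈𝒞 x = there (∈-++⁺ˡ (∈-map⁺ ⁅_⁆ (∈-allFin x)))

  K∈𝒞 : ∀ x → K x ∈ᴸ 𝒞
  K∈𝒞 x = there (∈-++⁺ʳ (map ⁅_⁆ (allFin n)) (∈-map⁺ K (∈-allFin x)))

  ⁅⁆⊆ : ∀ {x} {D : Subset n} → x ∈ D → ⁅ x ⁆ ⊆ D
  ⁅⁆⊆ {D = D} x∈D y∈⁅x⁆ = subst (_∈ D) (sym (x∈⁅y⁆⇒x≡y _ y∈⁅x⁆)) x∈D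

  clusters-laminar : ∀ {C D : Subset n} {x} → Cluster C → Cluster D → x ∈ C → x ∈ D → C ⊆ D ⊎ D ⊆ C
  clusters-laminar whole _ _ _ = inj₂ ⊆⊤
  clusters-laminar _ whole _ _ = inj₁ ⊆⊤
  clusters-laminar {D = D} (singleton s) _ x∈⁅s⁆ x∈D =
    inj₁ (⁅⁆⊆ (subst (_∈ D) (x∈⁅y⁆⇒x≡y s x∈⁅s⁆) x∈D))
  clusters-laminar {C = C} _ (singleton s) x∈C x∈⁅s⁆ =
    inj₂ (⁅⁆⊆ (subst (_∈ C) (x∈⁅y⁆⇒x≡y s x∈⁅s⁆) x∈C))
  clusters-laminar (K-of v) (K-of w) x∈Kv x∈Kw =
    Sum.map ⊑⇒K⊆ ⊑⇒K⊆ (K-laminar (∈⟦⟧⁻ (inK? v) x∈Kv) (∈⟦⟧⁻ (inK? w) x∈Kw))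

  open Hierarchy 𝒞 (λ C∈ D∈ → clusters-laminar (cluster C∈) (cluster D∈)) (here refl) ⁅⁆∈𝒞

  arc⇒spans : ∀ {x y y′} → Arc G x y → σ y′ ≡ σ y → y ∈⟨ x , y′ ⟩
  arc⇒spans {x} {y} {y′} xy y′~y {C} C∈ x∈C y′∈C with cluster C∈
  ... | whole   = ∈⊤
  ... | K-of v  = ∈⟦⟧⁺ (inK? v) (InK-arc xy (∈⟦⟧⁻ (inK? v) x∈C))
  ... | singleton s = ⊥-elim (arc-colours xy (trans (cong σ x≡y′) y′~y))
    where
    x≡y′ : x ≡ y′
    x≡y′ = trans (x∈⁅y⁆⇒x≡y s x∈C) (sym (x∈⁅y⁆⇒x≡y s y′∈C))

  spans⇒arc : ∀ {x y} → HasOut x → σ x ≢ σ y → (∀ y′ → σ y′ ≡ σ y → y ∈⟨ x , y′ ⟩) → Arc G x y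
  spans⇒arc {x} {y} (z , xz) x≁y spans
    with ∈⟦⟧⁻ (inK? x) (spans z z~y (K∈𝒞 x) (∈⟦⟧⁺ (inK? x) (InK-self (z , xz)))
                                            (∈⟦⟧⁺ (inK? x) (inj₁ xz)))
    where
    z~y : σ z ≡ σ y
    z~y = ≢-≢⇒≡ (≢-sym (arc-colours xz)) x≁y
  ... | inj₁ xy        = xy
  ... | inj₂ (y~x , _) = ⊥-elim (x≁y (sym y~x))

  -- A sink is truncated at its own leaf, which removes all its best matches;
  -- other vertices are not truncated at all.
  truncation : Fin n → Fin 2 → Pos
  truncation x s with hasOut? x | s ≟ᶠ σ x
  ... | yes _ | no _  = []
  ... | yes _ | yes _ = pos x
  ... | no _  | _     = pos x

  truncation-⪯ : ∀ x s → pos x ⪯ truncation x s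
  truncation-⪯ x s with hasOut? x | s ≟ᶠ σ x
  ... | yes _ | no _  = []
  ... | yes _ | yes _ = ⪯-refl (pos x)
  ... | no _  | _     = ⪯-refl (pos x)

  truncation-own : ∀ x → truncation x (σ x) ≡ pos x
  truncation-own x with hasOut? x | σ x ≟ᶠ σ x
  ... | yes _ | no x≁x = ⊥-elim (x≁x refl)
  ... | yes _ | yes _  = refl
  ... | no _  | _      = refl

  truncation-root : ∀ {x s} → HasOut x → s ≢ σ x → truncation x s ≡ []
  truncation-root {x} {s} out s≁x with hasOut? x | s ≟ᶠ σ x
  ... | no ¬out | _       = ⊥-elim (¬out out)
  ... | yes _   | yes s~x = ⊥-elim (s≁x s~x)
  ... | yes _   | no _    = refl

  arc⇔qbm : ∀ x y → Arc G x y ⇔ QuasiBestMatch pos σ truncation x y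
  arc⇔qbm x y = mk⇔ arc⇒qbm qbm⇒arc
    where
    arc⇒qbm : Arc G x y → QuasiBestMatch pos σ truncation x y
    arc⇒qbm xy = (arc-colours xy , best)
               , subst (lca (pos x) (pos y) ⪯_)
                       (sym (truncation-root (y , xy) (≢-sym (arc-colours xy)))) []
      where
      best : ∀ y′ → σ y′ ≡ σ y → lca (pos x) (pos y) ⪯ lca (pos x) (pos y′)
      best y′ y′~y = lca-least (⪯-lcaˡ (pos x) (pos y′))
                       (Equivalence.from below-lca⇔spans (arc⇒spans xy y′~y))

    qbm⇒arc : QuasiBestMatch pos σ truncation x y → Arc G x y
    qbm⇒arc ((x≁y , best) , truncated) with hasOut? x
    ... | yes out = spans⇒arc out x≁y λ y′ y′~y →
      Equivalence.to below-lca⇔spans (⪯-trans (⪯-lcaʳ (pos x) (pos y)) (best y′ y′~y))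
    ... | no ¬out = ⊥-elim (x≁y (cong σ (sym (x∈⁅y⁆⇒x≡y x (y∈⟨x,x⟩ (⁅⁆∈𝒞 x) (x∈⁅x⁆ x) (x∈⁅x⁆ x))))))
      where
      y⪯x : pos y ⪯ lca (pos x) (pos x)
      y⪯x = subst (pos y ⪯_) (sym (lca-idem (pos x)))
              (⪯-trans (⪯-lcaʳ (pos x) (pos y)) truncated)
      y∈⟨x,x⟩ : y ∈⟨ x , x ⟩
      y∈⟨x,x⟩ = Equivalence.to below-lca⇔spans y⪯x

  N1∧N2∧N3⇒qBMG : 0 < n → qBMG G σ
  N1∧N2∧N3⇒qBMG 0<n = 𝒯 , 𝒯-phylogenetic (fromℕ< 0<n) , pos , 𝒯-leaves
                    , truncation , (truncation-⪯ , truncation-own) , arc⇔qbm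

theorem5 : ∀ {n} → 0 < n → (G : Digraph n) (σ : Coloring n) → Proper G σ →
           (qBMG G σ ⇔ (N1 G × N2 G × N3 G))
theorem5 0<n G σ proper = mk⇔ (qBMG⇒N1∧N2∧N3 {G = G} {σ})
  λ (n1 , n2 , n3) → Clusters.N1∧N2∧N3⇒qBMG {G = G} {σ} proper n1 n2 n3 0<n
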